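{- Let $G$ and $H$ be connected graphs. If $\mathcal{S}(G)$ is an independent set of $G$ and $\mu_t(G) = |\mathcal{S}(G)|$, then $$\mu_t(G\Box H) = \mu_t(G)\mu_t(H).$$
   Context: All graphs are finite, simple and undirected. A vertex is simplicial if its neighbours induce a complete graph; $\mathcal{S}(G)$ is the set of simplicial vertices of $G$. The Cartesian product $G\Box H$ has vertex set $V(G)\times V(H)$, with $(x,y)$ adjacent to $(x',y')$ iff either $x=x'$ and $yy'\in E(H)$, or $xx'\in E(G)$ and $y=y'$. For a graph $F$ and $X\subseteq V(F)$, two vertices $x,y$ are $X$-visible if there is a shortest $x,y$-path in $F$ none of whose internal vertices lies in $X$. $X$ is a total mutual-visibility set of $F$ if every two vertices of $F$ are $X$-visible; $\mu_t(F)$ is the maximum cardinality of such a set. -}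

module Defs where

open import Data.Nat using (ℕ; zero; suc; _*_; _<_; _≤_)
open import Data.Fin using (Fin; zero; suc; fromℕ; inject₁; remQuot)
open import Data.Fin.Subset using (Subset; _∈_; _∉_; ∣_∣)
open import Data.Product using (Σ; _×_; _,_; proj₁; proj₂; ∃)
open import Data.Sum using (_⊎_; inj₁; inj₂)
open import Data.Empty using (⊥)
open import Relation.Nullary using (¬_)
open import Relation.Binary.PropositionalEquality using (_≡_; _≢_; sym)
open import Function.Bundles using (_⇔_)

record Graph : Set₁ where
  field
    n       : ℕ
    Adj     : Fin n → Fin n → Set
    Adj-sym : ∀ {x y} → Adj x y → Adj y x
    Adj-irr : ∀ {x} → ¬ Adj x x
open Graph public

Vertex : Graph → Set
Vertex G = Fin (n G)

record Walk (G : Graph) (x y : Vertex G) (k : ℕ) : Set where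
  field
    at    : Fin (suc k) → Vertex G
    start : at zero ≡ x
    end   : at (fromℕ k) ≡ y
    steps : (i : Fin k) → Adj G (at (inject₁ i)) (at (suc i))
open Walk public

Connected : Graph → Set
Connected G = ∀ (x y : Vertex G) → ∃ λ k → Walk G x y k

IsShortest : (G : Graph) {x y : Vertex G} {k : ℕ} → Walk G x y k → Set
IsShortest G {x} {y} {k} _ = ∀ k′ → k′ < k → ¬ Walk G x y k′

InternallyAvoids : (G : Graph) {x y : Vertex G} {k : ℕ} → Walk G x y k → Subset (n G) → Set
InternallyAvoids G {k = k} w X =
  ∀ (i : Fin (suc k)) → i ≢ zero → i ≢ fromℕ k → at w i ∉ X

Visible : (G : Graph) → Subset (n G) → Vertex G → Vertex G → Set
Visible G X x y =
  Σ ℕ λ k → Σ (Walk G x y k) λ w → IsShortest G w × InternallyAvoids G w X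

IsTotalMutualVisibilitySet : (G : Graph) → Subset (n G) → Set
IsTotalMutualVisibilitySet G X = ∀ (x y : Vertex G) → Visible G X x y

IsMuT : Graph → ℕ → Set
IsMuT G m =
  (Σ (Subset (n G)) λ X → IsTotalMutualVisibilitySet G X × ∣ X ∣ ≡ m)
  × (∀ (X : Subset (n G)) → IsTotalMutualVisibilitySet G X → ∣ X ∣ ≤ m)

Simplicial : (G : Graph) → Vertex G → Set
Simplicial G v = ∀ u w → Adj G v u → Adj G v w → u ≢ w → Adj G u w

Independent : (G : Graph) → Subset (n G) → Set
Independent G S = ∀ u v → u ∈ S → v ∈ S → ¬ Adj G u v

-- Cartesian product; vertex i of G □ H encodes the pair remQuot i ∈ V(G) × V(H).
□Adj : (G H : Graph) → Fin (n G * n H) → Fin (n G * n H) → Set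
□Adj G H i j with remQuot {n G} (n H) i | remQuot {n G} (n H) j
... | x , y | x′ , y′ = (x ≡ x′ × Adj H y y′) ⊎ (Adj G x x′ × y ≡ y′)

□Adj-sym : (G H : Graph) → ∀ {i j} → □Adj G H i j → □Adj G H j i
□Adj-sym G H {i} {j} a with remQuot {n G} (n H) i | remQuot {n G} (n H) j
... | x , y | x′ , y′ with a
...   | inj₁ (e , h) = inj₁ (sym e , Adj-sym H h)
...   | inj₂ (g , e) = inj₂ (Adj-sym G g , sym e)

□Adj-irr : (G H : Graph) → ∀ {i} → ¬ □Adj G H i i
□Adj-irr G H {i} a with remQuot {n G} (n H) i
... | x , y with a
...   | inj₁ (_ , h) = Adj-irr H h
...   | inj₂ (g , _) = Adj-irr G g

_□_ : Graph → Graph → Graph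
G □ H = record
  { n = n G * n H
  ; Adj = □Adj G H
  ; Adj-sym = □Adj-sym G H
  ; Adj-irr = □Adj-irr G H
  }

{-# OPTIONS --safe #-}
-- A simplicial vertex is never internal to a shortest path, since its two neighbours on the path are
-- adjacent. So when μ_t(G) = |S(G)| every total mutual-visibility set of G lies inside S(G): adding S(G)
-- to it would otherwise give a larger one. If Z is a total mutual-visibility set of G □ H, each of its
-- G-layers is one of G and each of its H-layers one of H; hence Z ⊆ S(G) × V(H) with at most μ_t(H)
-- vertices in every H-layer. Conversely S(G) × Y is a total mutual-visibility set for an optimal Y of H:
-- between (g, h) and (g′, h′) walk a shortest g,g′-path in G and insert a Y-avoiding shortest h,h′-path
-- of H in a layer whose G-vertex is outside S(G); one exists along the G-path because S(G) is independent.
module Submission where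

open import Defs
open import Data.Nat using (ℕ; zero; suc; _+_; _*_; _<_; _≤_; z≤n; s≤s; _≤?_)
open import Data.Nat.Properties
  using (≤-refl; ≤-trans; ≤-reflexive; <-irrefl; ≰⇒>; n≤1+n; m≤m+n; +-mono-≤; +-suc; +-comm; +-0-monoid)
open import Algebra.Properties.Monoid.Sum +-0-monoid using (sum-syntax)
open import Data.Fin using (Fin; zero; suc; fromℕ; remQuot; combine; _↑ˡ_; _↑ʳ_; _≟_)
open import Data.Fin.Properties using (suc-injective; remQuot-combine; combine-remQuot)
open import Data.Fin.Subset using (Subset; _∈_; _∉_; _⊆_; _⊂_; _∪_; _∩_; ∣_∣)
open import Data.Fin.Subset.Properties
  using (_∈?_; drop-there; p⊆p∪q; x∈p∪q⁺; x∈p∪q⁻; x∈p∩q⁺; x∈p∩q⁻; p⊂q⇒∣p∣<∣q∣;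
         ⊆-antisym; Empty-unique; ∣⊥∣≡0)
open import Data.Vec using (_∷_; []; lookup; tabulate; here; there)
open import Data.Vec.Properties using (lookup∘tabulate; []=⇒lookup; lookup⇒[]=; tabulate∘lookup)
open import Data.Product using (Σ; _×_; _,_; proj₁; proj₂)
open import Data.Sum using (_⊎_; inj₁; inj₂)
open import Data.Bool using (Bool; true; false)
open import Data.Empty using (⊥-elim)
open import Data.Unit using (⊤; tt)
open import Function using (_∘_)
open import Function.Bundles using (_⇔_; Equivalence)
open import Relation.Nullary using (¬_; yes; no)
open import Relation.Binary.PropositionalEquality
  using (_≡_; _≢_; refl; sym; trans; cong; cong₂; subst; subst₂)

-- Walks as an inductive family, for recursion; toWalk and fromWalk translate to the record walks of Defs.
data Walkᵢ (G : Graph) : Vertex G → Vertex G → ℕ → Set where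
  ε   : ∀ {x} → Walkᵢ G x x 0
  _◅_ : ∀ {x y z k} → Adj G x y → Walkᵢ G y z k → Walkᵢ G x z (suc k)

infixr 5 _◅_

NoShorter : (G : Graph) → Vertex G → Vertex G → ℕ → Set
NoShorter G x y k = ∀ k′ → k′ < k → ¬ Walkᵢ G x y k′

Geodesic : (G : Graph) → Vertex G → Vertex G → Set
Geodesic G x y = Σ ℕ λ k → Walkᵢ G x y k × NoShorter G x y k

module _ {G : Graph} where

  AllButLast : (Vertex G → Set) → ∀ {x y k} → Walkᵢ G x y k → Set
  AllButLast Q ε = ⊤
  AllButLast Q (_◅_ {x} _ w) = Q x × AllButLast Q w

  Internal : (Vertex G → Set) → ∀ {x y k} → Walkᵢ G x y k → Set
  Internal Q ε = ⊤
  Internal Q (_ ◅ w) = AllButLast Q w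

  infixr 5 _◅◅_
  _◅◅_ : ∀ {x y z a b} → Walkᵢ G x y a → Walkᵢ G y z b → Walkᵢ G x z (a + b)
  ε ◅◅ w = w
  (e ◅ v) ◅◅ w = e ◅ (v ◅◅ w)

  module _ {Q : Vertex G → Set} where

    internal⇒allButLast : ∀ {x y k} (w : Walkᵢ G x y k) → Q x → Internal Q w → AllButLast Q w
    internal⇒allButLast ε _ _ = tt
    internal⇒allButLast (_ ◅ _) q r = q , r

    allButLast-◅◅ : ∀ {x y z a b} (v : Walkᵢ G x y a) (w : Walkᵢ G y z b) →
                    AllButLast Q v → AllButLast Q w → AllButLast Q (v ◅◅ w)
    allButLast-◅◅ ε w _ r = r
    allButLast-◅◅ (e ◅ v) w (q , p) r = q , allButLast-◅◅ v w p r

    internal-◅◅ : ∀ {x y z a b} (v : Walkᵢ G x y a) (w : Walkᵢ G y z b) →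
                  Internal Q v → Q y → Internal Q w → Internal Q (v ◅◅ w)
    internal-◅◅ ε w _ _ r = r
    internal-◅◅ (e ◅ v) w p q r = allButLast-◅◅ v w p (internal⇒allButLast w q r)

  module _ {Q₁ Q₂ Q : Vertex G → Set} (f : ∀ {v} → Q₁ v → Q₂ v → Q v) where

    allButLast-zipWith : ∀ {x y k} (w : Walkᵢ G x y k) → AllButLast Q₁ w → AllButLast Q₂ w → AllButLast Q w
    allButLast-zipWith ε _ _ = tt
    allButLast-zipWith (e ◅ w) (q₁ , p₁) (q₂ , p₂) = f q₁ q₂ , allButLast-zipWith w p₁ p₂

    internal-zipWith : ∀ {x y k} (w : Walkᵢ G x y k) → Internal Q₁ w → Internal Q₂ w → Internal Q w
    internal-zipWith ε _ _ = tt
    internal-zipWith (e ◅ w) = allButLast-zipWith w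

  noShorter-tail : ∀ {x y z k} → Adj G x y → NoShorter G x z (suc k) → NoShorter G y z k
  noShorter-tail e sh k′ k′<k w = sh (suc k′) (s≤s k′<k) (e ◅ w)

module _ {K G : Graph} (f : Vertex K → Vertex G) (f-adj : ∀ {x y} → Adj K x y → Adj G (f x) (f y)) where

  mapᵢ : ∀ {x y k} → Walkᵢ K x y k → Walkᵢ G (f x) (f y) k
  mapᵢ ε = ε
  mapᵢ (e ◅ w) = f-adj e ◅ mapᵢ w

  module _ {Q₁ : Vertex K → Set} {Q₂ : Vertex G → Set} (q : ∀ {v} → Q₁ v → Q₂ (f v)) where

    allButLast-mapᵢ : ∀ {x y k} (w : Walkᵢ K x y k) → AllButLast Q₁ w → AllButLast Q₂ (mapᵢ w)
    allButLast-mapᵢ ε _ = tt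
    allButLast-mapᵢ (e ◅ w) (q₁ , p) = q q₁ , allButLast-mapᵢ w p

    internal-mapᵢ : ∀ {x y k} (w : Walkᵢ K x y k) → Internal Q₁ w → Internal Q₂ (mapᵢ w)
    internal-mapᵢ ε _ = tt
    internal-mapᵢ (e ◅ w) = allButLast-mapᵢ w

module _ {G : Graph} where

  toWalk : ∀ {x y k} → Walkᵢ G x y k → Walk G x y k
  toWalk {x} ε = record { at = λ _ → x ; start = refl ; end = refl ; steps = λ () }
  toWalk {x} (e ◅ w) = record
    { at    = λ { zero → x ; (suc i) → at w′ i }
    ; start = refl
    ; end   = end w′
    ; steps = λ { zero → subst (Adj G x) (sym (start w′)) e ; (suc i) → steps w′ i }
    }
    where w′ = toWalk w

  tailWalk : ∀ {x y k} (w : Walk G x y (suc k)) → Walk G (at w (suc zero)) y k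
  tailWalk w = record { at = at w ∘ suc ; start = refl ; end = end w ; steps = steps w ∘ suc }

  fromWalk : ∀ {x y k} → Walk G x y k → Walkᵢ G x y k
  fromWalk {k = zero} w = subst₂ (λ a b → Walkᵢ G a b 0) (start w) (end w) ε
  fromWalk {k = suc k} w =
    subst (λ v → Adj G v (at w (suc zero))) (start w) (steps w zero) ◅ fromWalk (tailWalk w)

  module _ {Q : Vertex G → Set} where

    allButLast-length0 : ∀ {x y} (w : Walkᵢ G x y 0) → AllButLast Q w
    allButLast-length0 ε = tt

    internal-length0 : ∀ {x y} (w : Walkᵢ G x y 0) → Internal Q w
    internal-length0 ε = tt

    allButLast⇒at : ∀ {x y k} (w : Walkᵢ G x y k) → AllButLast Q w → ∀ i → i ≢ fromℕ k → Q (at (toWalk w) i)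
    allButLast⇒at ε _ zero i≢0 = ⊥-elim (i≢0 refl)
    allButLast⇒at (e ◅ w) (q , _) zero _ = q
    allButLast⇒at (e ◅ w) (_ , p) (suc i) i≢k = allButLast⇒at w p i (i≢k ∘ cong suc)

    internal⇒at : ∀ {x y k} (w : Walkᵢ G x y k) → Internal Q w →
                  ∀ i → i ≢ zero → i ≢ fromℕ k → Q (at (toWalk w) i)
    internal⇒at ε _ zero i≢0 _ = ⊥-elim (i≢0 refl)
    internal⇒at (e ◅ w) _ zero i≢0 _ = ⊥-elim (i≢0 refl)
    internal⇒at (e ◅ w) p (suc i) _ i≢k = allButLast⇒at w p i (i≢k ∘ cong suc)

    at⇒allButLast : ∀ {x y k} (w : Walk G x y k) → (∀ i → i ≢ fromℕ k → Q (at w i)) → AllButLast Q (fromWalk w)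
    at⇒allButLast {k = zero} w _ = allButLast-length0 (fromWalk w)
    at⇒allButLast {k = suc _} w q =
      subst Q (start w) (q zero λ ()) , at⇒allButLast (tailWalk w) λ i i≢k → q (suc i) (i≢k ∘ suc-injective)

    at⇒internal : ∀ {x y k} (w : Walk G x y k) →
                  (∀ i → i ≢ zero → i ≢ fromℕ k → Q (at w i)) → Internal Q (fromWalk w)
    at⇒internal {k = zero} w _ = internal-length0 (fromWalk w)
    at⇒internal {k = suc _} w q = at⇒allButLast (tailWalk w) λ i i≢k → q (suc i) (λ ()) (i≢k ∘ suc-injective)

Visibleᵢ : (G : Graph) → Subset (n G) → Vertex G → Vertex G → Set
Visibleᵢ G X x y = Σ ℕ λ k → Σ (Walkᵢ G x y k) λ w → NoShorter G x y k × Internal (_∉ X) w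

module _ {G : Graph} {X : Subset (n G)} {x y : Vertex G} where

  Visibleᵢ⇒Visible : Visibleᵢ G X x y → Visible G X x y
  Visibleᵢ⇒Visible (k , w , sh , r) = k , toWalk w , (λ k′ k′<k → sh k′ k′<k ∘ fromWalk) , internal⇒at w r

  Visible⇒Visibleᵢ : Visible G X x y → Visibleᵢ G X x y
  Visible⇒Visibleᵢ (k , w , sh , r) = k , fromWalk w , (λ k′ k′<k → sh k′ k′<k ∘ toWalk) , at⇒internal w r

  Visible⇒Geodesic : Visible G X x y → Geodesic G x y
  Visible⇒Geodesic vis with Visible⇒Visibleᵢ vis
  ... | k , w , sh , _ = k , w , sh

module _ {G : Graph} {S : Subset (n G)} (S-simplicial : ∀ {v} → v ∈ S → Simplicial G v) where

  -- A simplicial internal vertex could be bypassed through the edge (or equality) of its two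
  -- neighbours on the walk.
  allButLast-∉-simplicial : ∀ {x y z k} → Adj G x y → (w : Walkᵢ G y z k) → NoShorter G x z (suc k) →
                            AllButLast (_∉ S) w
  allButLast-∉-simplicial e ε sh = tt
  allButLast-∉-simplicial {x} e (_◅_ {y = u} {k = k} e′ w) sh =
    y∉S , allButLast-∉-simplicial e′ w (noShorter-tail e sh)
    where
    y∉S : _ ∉ S
    y∉S y∈S with x ≟ u
    ... | yes refl = sh k (s≤s (n≤1+n k)) w
    ... | no x≢u = sh (suc k) ≤-refl (S-simplicial y∈S x u (Adj-sym G e) e′ x≢u ◅ w)

  internal-∉-simplicial : ∀ {x y k} (w : Walkᵢ G x y k) → NoShorter G x y k → Internal (_∉ S) w
  internal-∉-simplicial ε _ = tt
  internal-∉-simplicial (e ◅ w) = allButLast-∉-simplicial e w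

  tmv-∪-simplicial : ∀ {X} → IsTotalMutualVisibilitySet G X → IsTotalMutualVisibilitySet G (S ∪ X)
  tmv-∪-simplicial {X} tmvX x y with Visible⇒Visibleᵢ (tmvX x y)
  ... | k , w , sh , r = Visibleᵢ⇒Visible (k , w , sh , internal-zipWith ∉∪ w (internal-∉-simplicial w sh) r)
    where
    ∉∪ : ∀ {v} → v ∉ S → v ∉ X → v ∉ S ∪ X
    ∉∪ v∉S v∉X v∈S∪X with x∈p∪q⁻ S X v∈S∪X
    ... | inj₁ v∈S = v∉S v∈S
    ... | inj₂ v∈X = v∉X v∈X

  tmv⊆simplicial : (∀ X → IsTotalMutualVisibilitySet G X → ∣ X ∣ ≤ ∣ S ∣) →
                   ∀ {X} → IsTotalMutualVisibilitySet G X → X ⊆ S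
  tmv⊆simplicial maximal {X} tmvX {x} x∈X with x ∈? S
  ... | yes x∈S = x∈S
  ... | no x∉S = ⊥-elim (<-irrefl refl (≤-trans (p⊂q⇒∣p∣<∣q∣ S⊂S∪X) (maximal (S ∪ X) (tmv-∪-simplicial tmvX))))
    where
    S⊂S∪X : S ⊂ S ∪ X
    S⊂S∪X = p⊆p∪q X , x , x∈p∪q⁺ (inj₂ x∈X) , x∉S

preimage : ∀ {m k} → (Fin m → Fin k) → Subset k → Subset m
preimage f A = tabulate (lookup A ∘ f)

module _ {m k} (f : Fin m → Fin k) (A : Subset k) {x : Fin m} where

  ∈-preimage⁻ : x ∈ preimage f A → f x ∈ A
  ∈-preimage⁻ x∈ = lookup⇒[]= (f x) A (trans (sym (lookup∘tabulate (lookup A ∘ f) x)) ([]=⇒lookup x∈))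

  ∈-preimage⁺ : f x ∈ A → x ∈ preimage f A
  ∈-preimage⁺ fx∈ = lookup⇒[]= x (preimage f A) (trans (lookup∘tabulate (lookup A ∘ f) x) ([]=⇒lookup fx∈))

∣tabulate∣-++ : ∀ a {b} (f : Fin (a + b) → Bool) →
                ∣ tabulate f ∣ ≡ ∣ tabulate (f ∘ (_↑ˡ b)) ∣ + ∣ tabulate (f ∘ (a ↑ʳ_)) ∣
∣tabulate∣-++ zero f = refl
∣tabulate∣-++ (suc a) f with f zero
... | true = cong suc (∣tabulate∣-++ a (f ∘ suc))
... | false = ∣tabulate∣-++ a (f ∘ suc)

∣∣-rows : ∀ m {k} (Z : Subset (m * k)) → ∣ Z ∣ ≡ ∑[ g < m ] ∣ preimage (combine g) Z ∣
∣∣-rows m Z = trans (cong ∣_∣ (sym (tabulate∘lookup Z))) (∣tabulate∣-combine m (lookup Z))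
  where
  ∣tabulate∣-combine : ∀ m {k} (f : Fin (m * k) → Bool) → ∣ tabulate f ∣ ≡ ∑[ g < m ] ∣ tabulate (f ∘ combine g) ∣
  ∣tabulate∣-combine zero f = refl
  ∣tabulate∣-combine (suc m) {k} f =
    trans (∣tabulate∣-++ k f) (cong (∣ tabulate (f ∘ (_↑ˡ m * k)) ∣ +_) (∣tabulate∣-combine m (f ∘ (k ↑ʳ_))))

module _ {c : ℕ} where

  ∑F≤∣S∣*c : ∀ {m} (S : Subset m) (F : Fin m → ℕ) → (∀ {g} → g ∈ S → F g ≤ c) → (∀ {g} → g ∉ S → F g ≡ 0) →
             ∑[ g < m ] F g ≤ ∣ S ∣ * c
  ∑F≤∣S∣*c [] F _ _ = z≤n
  ∑F≤∣S∣*c (true ∷ S) F inS outS =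
    +-mono-≤ (inS here) (∑F≤∣S∣*c S (F ∘ suc) (inS ∘ there) (outS ∘ (_∘ drop-there)))
  ∑F≤∣S∣*c (false ∷ S) F inS outS rewrite outS {zero} (λ ()) =
    ∑F≤∣S∣*c S (F ∘ suc) (inS ∘ there) (outS ∘ (_∘ drop-there))

  ∑F≡∣S∣*c : ∀ {m} (S : Subset m) (F : Fin m → ℕ) → (∀ {g} → g ∈ S → F g ≡ c) → (∀ {g} → g ∉ S → F g ≡ 0) →
             ∑[ g < m ] F g ≡ ∣ S ∣ * c
  ∑F≡∣S∣*c [] F _ _ = refl
  ∑F≡∣S∣*c (true ∷ S) F inS outS =
    cong₂ _+_ (inS here) (∑F≡∣S∣*c S (F ∘ suc) (inS ∘ there) (outS ∘ (_∘ drop-there)))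
  ∑F≡∣S∣*c (false ∷ S) F inS outS rewrite outS {zero} (λ ()) =
    ∑F≡∣S∣*c S (F ∘ suc) (inS ∘ there) (outS ∘ (_∘ drop-there))

-- G □ H up to isomorphism; unlike the encoding in Defs this notion is symmetric in G and H (see swap).
record IsCartesianProduct (P G H : Graph) : Set where
  field
    fst          : Vertex P → Vertex G
    snd          : Vertex P → Vertex H
    pair         : Vertex G → Vertex H → Vertex P
    fst-pair     : ∀ g h → fst (pair g h) ≡ g
    snd-pair     : ∀ g h → snd (pair g h) ≡ h
    pair-fst-snd : ∀ i → pair (fst i) (snd i) ≡ i
    adj-cases    : ∀ {i j} → Adj P i j →
                   (Adj G (fst i) (fst j) × snd i ≡ snd j) ⊎ (fst i ≡ fst j × Adj H (snd i) (snd j))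
    pair-adjˡ    : ∀ {g g′ h} → Adj G g g′ → Adj P (pair g h) (pair g′ h)
    pair-adjʳ    : ∀ {g h h′} → Adj H h h′ → Adj P (pair g h) (pair g h′)

swap : ∀ {P G H} → IsCartesianProduct P G H → IsCartesianProduct P H G
swap C = record
  { fst = snd ; snd = fst ; pair = λ h g → pair g h
  ; fst-pair = λ h g → snd-pair g h ; snd-pair = λ h g → fst-pair g h ; pair-fst-snd = pair-fst-snd
  ; adj-cases = swap-cases ∘ adj-cases
  ; pair-adjˡ = pair-adjʳ ; pair-adjʳ = pair-adjˡ
  }
  where
  open IsCartesianProduct C
  swap-cases : ∀ {A B C D : Set} → (A × B) ⊎ (C × D) → (D × C) ⊎ (B × A)
  swap-cases (inj₁ (a , b)) = inj₂ (b , a)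
  swap-cases (inj₂ (c , d)) = inj₁ (d , c)

□-isCartesianProduct : ∀ G H → IsCartesianProduct (G □ H) G H
□-isCartesianProduct G H = record
  { fst = fst ; snd = snd ; pair = combine
  ; fst-pair = fst-pair ; snd-pair = snd-pair ; pair-fst-snd = combine-remQuot {n G} (n H)
  ; adj-cases = λ {i} {j} → adj-cases i j
  ; pair-adjˡ = λ {g} {g′} {h} e →
      adj-intro (combine g h) (combine g′ h) (inj₂ (subst₂ (Adj G) (sym (fst-pair g h)) (sym (fst-pair g′ h)) e
                                                   , trans (snd-pair g h) (sym (snd-pair g′ h))))
  ; pair-adjʳ = λ {g} {h} {h′} e →
      adj-intro (combine g h) (combine g h′) (inj₁ (trans (fst-pair g h) (sym (fst-pair g h′))
                                                   , subst₂ (Adj H) (sym (snd-pair g h)) (sym (snd-pair g h′)) e))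
  }
  where
  fst : Vertex (G □ H) → Vertex G
  fst = proj₁ ∘ remQuot {n G} (n H)
  snd : Vertex (G □ H) → Vertex H
  snd = proj₂ ∘ remQuot {n G} (n H)
  fst-pair : ∀ g h → fst (combine g h) ≡ g
  fst-pair g h = cong proj₁ (remQuot-combine {n G} {n H} g h)
  snd-pair : ∀ g h → snd (combine g h) ≡ h
  snd-pair g h = cong proj₂ (remQuot-combine {n G} {n H} g h)
  adj-cases : ∀ i j → □Adj G H i j →
              (Adj G (fst i) (fst j) × snd i ≡ snd j) ⊎ (fst i ≡ fst j × Adj H (snd i) (snd j))
  adj-cases i j a with remQuot {n G} (n H) i | remQuot {n G} (n H) j
  ... | _ | _ with a
  ...   | inj₁ hstep = inj₂ hstep
  ...   | inj₂ gstep = inj₁ gstep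
  adj-intro : ∀ i j → (fst i ≡ fst j × Adj H (snd i) (snd j)) ⊎ (Adj G (fst i) (fst j) × snd i ≡ snd j) →
              □Adj G H i j
  adj-intro i j a with remQuot {n G} (n H) i | remQuot {n G} (n H) j
  ... | _ | _ = a

module CartesianProduct {P G H : Graph} (C : IsCartesianProduct P G H) where
  open IsCartesianProduct C

  liftˡ : ∀ h {g g′ k} → Walkᵢ G g g′ k → Walkᵢ P (pair g h) (pair g′ h) k
  liftˡ h = mapᵢ (λ g → pair g h) pair-adjˡ

  liftʳ : ∀ g {h h′ k} → Walkᵢ H h h′ k → Walkᵢ P (pair g h) (pair g h′) k
  liftʳ g = mapᵢ (pair g) pair-adjʳ

  split : ∀ {i j k} → Walkᵢ P i j k →
          Σ ℕ λ a → Σ ℕ λ b → a + b ≡ k × Walkᵢ G (fst i) (fst j) a × Walkᵢ H (snd i) (snd j) b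
  split ε = 0 , 0 , refl , ε , ε
  split {j = j} (e ◅ w) with split w | adj-cases e
  ... | a , b , a+b≡k , u , v | inj₁ (eG , snd≡) =
    suc a , b , cong suc a+b≡k , eG ◅ u , subst (λ h → Walkᵢ H h (snd j) b) (sym snd≡) v
  ... | a , b , a+b≡k , u , v | inj₂ (fst≡ , eH) =
    a , suc b , trans (+-suc a b) (cong suc a+b≡k) , subst (λ g → Walkᵢ G g (fst j) a) (sym fst≡) u , eH ◅ v

  noShorter-pair : ∀ {g g′ h h′ a b} → NoShorter G g g′ a → NoShorter H h h′ b →
                   NoShorter P (pair g h) (pair g′ h′) (a + b)
  noShorter-pair {g} {g′} {h} {h′} {a} {b} shG shH k′ k′<a+b w with split w
  ... | a′ , b′ , refl , u , v with a ≤? a′ | b ≤? b′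
  ... | no a≰a′ | _ = shG a′ (≰⇒> a≰a′) (subst₂ (λ x y → Walkᵢ G x y a′) (fst-pair g h) (fst-pair g′ h′) u)
  ... | yes _ | no b≰b′ = shH b′ (≰⇒> b≰b′) (subst₂ (λ x y → Walkᵢ H x y b′) (snd-pair g h) (snd-pair g′ h′) v)
  ... | yes a≤a′ | yes b≤b′ = <-irrefl refl (≤-trans k′<a+b (+-mono-≤ a≤a′ b≤b′))

  layer : Subset (n P) → Vertex H → Subset (n G)
  layer Z h = preimage (λ g → pair g h) Z

  module _ {h : Vertex H} where

    pair-fst : ∀ {i} → snd i ≡ h → pair (fst i) h ≡ i
    pair-fst {i} refl = pair-fst-snd i

    liftˡ-within : ∀ {i j a} → snd i ≡ h → snd j ≡ h → Walkᵢ G (fst i) (fst j) a → Walkᵢ P i j a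
    liftˡ-within {a = a} i∈h j∈h u = subst₂ (λ x y → Walkᵢ P x y a) (pair-fst i∈h) (pair-fst j∈h) (liftˡ h u)

    noShorter-within : ∀ {i j k} → snd i ≡ h → snd j ≡ h → NoShorter P i j k → NoShorter G (fst i) (fst j) k
    noShorter-within i∈h j∈h sh k′ k′<k = sh k′ k′<k ∘ liftˡ-within i∈h j∈h

    -- A shortest walk between two vertices of the layer never takes an H-step: the rest of the walk,
    -- projected to G and lifted back into the layer, would be a shorter walk.
    walk-within : ∀ {Q : Vertex P → Set} {Q′ : Vertex G → Set} → (∀ {i} → snd i ≡ h → Q i → Q′ (fst i)) →
                  ∀ {i j k} (w : Walkᵢ P i j k) → snd i ≡ h → snd j ≡ h → NoShorter P i j k →
                  Σ (Walkᵢ G (fst i) (fst j) k) λ v →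
                    (AllButLast Q w → AllButLast Q′ v) × (Internal Q w → Internal Q′ v)
    walk-within q ε _ _ _ = ε , (λ _ → tt) , (λ _ → tt)
    walk-within q (e ◅ w) i∈h j∈h sh with adj-cases e
    ... | inj₁ (eG , snd≡) with walk-within q w (trans (sym snd≡) i∈h) j∈h (noShorter-tail e sh)
    ...   | v , keep , _ = eG ◅ v , (λ (qi , r) → q i∈h qi , keep r) , keep
    walk-within q {j = j} (e ◅ w) i∈h j∈h sh | inj₂ (fst≡ , _) with split w
    ...   | a , b , refl , u , _ =
      ⊥-elim (sh a (s≤s (m≤m+n a b)) (liftˡ-within i∈h j∈h (subst (λ g → Walkᵢ G g (fst j) a) (sym fst≡) u)))

    visible-within : ∀ {Z i j} → snd i ≡ h → snd j ≡ h → Visible P Z i j → Visible G (layer Z h) (fst i) (fst j)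
    visible-within {Z} i∈h j∈h vis with Visible⇒Visibleᵢ vis
    ... | k , w , sh , r with walk-within avoid w i∈h j∈h sh
      where
      avoid : ∀ {i} → snd i ≡ h → i ∉ Z → fst i ∉ layer Z h
      avoid i∈h i∉Z = i∉Z ∘ subst (_∈ Z) (pair-fst i∈h) ∘ ∈-preimage⁻ (λ g → pair g h) Z
    ... | v , _ , transfer = Visibleᵢ⇒Visible (k , v , noShorter-within i∈h j∈h sh , transfer r)

  layer-tmv : ∀ {Z} h → IsTotalMutualVisibilitySet P Z → IsTotalMutualVisibilitySet G (layer Z h)
  layer-tmv h tmvZ g g′ =
    subst₂ (Visible G _) (fst-pair g h) (fst-pair g′ h) (visible-within (snd-pair g h) (snd-pair g′ h) (tmvZ _ _))

  prodSet : Subset (n G) → Subset (n H) → Subset (n P)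
  prodSet S Y = preimage fst S ∩ preimage snd Y

  module _ {S : Subset (n G)} {Y : Subset (n H)} where

    ∈prodSet⁻ : ∀ {g h} → pair g h ∈ prodSet S Y → g ∈ S × h ∈ Y
    ∈prodSet⁻ {g} {h} m with x∈p∩q⁻ (preimage fst S) (preimage snd Y) m
    ... | m₁ , m₂ = subst (_∈ S) (fst-pair g h) (∈-preimage⁻ fst S m₁) ,
                    subst (_∈ Y) (snd-pair g h) (∈-preimage⁻ snd Y m₂)

    ∈prodSet⁺ : ∀ {g h} → g ∈ S → h ∈ Y → pair g h ∈ prodSet S Y
    ∈prodSet⁺ {g} {h} g∈S h∈Y =
      x∈p∩q⁺ ( ∈-preimage⁺ fst S (subst (_∈ S) (sym (fst-pair g h)) g∈S)
             , ∈-preimage⁺ snd Y (subst (_∈ Y) (sym (snd-pair g h)) h∈Y))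

    ∉prodSetˡ : ∀ {g} h → g ∉ S → pair g h ∉ prodSet S Y
    ∉prodSetˡ _ g∉S = g∉S ∘ proj₁ ∘ ∈prodSet⁻

    ∉prodSetʳ : ∀ g {h} → h ∉ Y → pair g h ∉ prodSet S Y
    ∉prodSetʳ _ h∉Y = h∉Y ∘ proj₂ ∘ ∈prodSet⁻

    -- The H-walk is placed in the layer of the second vertex of u when u has length at least 2, and otherwise
    -- in the layer of an end of u outside S (for u of length 1 at most one end is in the independent set S).
    combineWalks : Independent G S → ∀ {g g′ h h′ a b} →
                   (u : Walkᵢ G g g′ a) → Internal (_∉ S) u → (v : Walkᵢ H h h′ b) → Internal (_∉ Y) v →
                   Σ ℕ λ k → k ≡ a + b × Σ (Walkᵢ P (pair g h) (pair g′ h′) k) (Internal (_∉ prodSet S Y))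
    combineWalks _ {g} {b = b} ε _ v v-avoids = b , refl , liftʳ g v , internal-mapᵢ _ _ (∉prodSetʳ g) v v-avoids
    combineWalks indep {g} {g′} {h} {h′} {b = b} (e ◅ ε) _ v v-avoids with g ∈? S
    ... | no g∉S =
      b + 1 , +-comm b 1 , liftʳ g v ◅◅ pair-adjˡ e ◅ ε ,
      internal-◅◅ (liftʳ g v) (pair-adjˡ e ◅ ε) (internal-mapᵢ _ _ (∉prodSetʳ g) v v-avoids) (∉prodSetˡ h′ g∉S) tt
    ... | yes g∈S =
      suc b , refl , pair-adjˡ e ◅ liftʳ g′ v ,
      internal⇒allButLast (liftʳ g′ v) (∉prodSetˡ h g′∉S) (internal-mapᵢ _ _ (∉prodSetʳ g′) v v-avoids)
      where
      g′∉S : g′ ∉ S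
      g′∉S g′∈S = indep g g′ g∈S g′∈S e
    combineWalks _ {h = h} {h′} {b = b} (_◅_ {y = g₁} e (_◅_ {k = a} e′ u)) (g₁∉S , u-avoids) v v-avoids =
      suc (b + suc a) , cong suc (+-comm b (suc a)) , pair-adjˡ e ◅ (liftʳ g₁ v ◅◅ liftˡ h′ (e′ ◅ u)) ,
      internal⇒allButLast (liftʳ g₁ v ◅◅ liftˡ h′ (e′ ◅ u)) (∉prodSetˡ h g₁∉S)
        (internal-◅◅ (liftʳ g₁ v) (liftˡ h′ (e′ ◅ u))
          (internal-mapᵢ _ _ (∉prodSetʳ g₁) v v-avoids) (∉prodSetˡ h′ g₁∉S)
          (internal-mapᵢ _ _ (∉prodSetˡ h′) (e′ ◅ u) u-avoids))

    prodSet-tmv : (∀ {v} → v ∈ S → Simplicial G v) → Independent G S → (∀ g g′ → Geodesic G g g′) →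
                  IsTotalMutualVisibilitySet H Y → IsTotalMutualVisibilitySet P (prodSet S Y)
    prodSet-tmv S-simplicial indep geodesic tmvY i j
      with geodesic (fst i) (fst j) | Visible⇒Visibleᵢ (tmvY (snd i) (snd j))
    ... | a , u , shG | b , v , shH , v-avoids
      with combineWalks indep u (internal-∉-simplicial S-simplicial u shG) v v-avoids
    ... | _ , refl , w , w-avoids =
      subst₂ (Visible P _) (pair-fst-snd i) (pair-fst-snd j)
        (Visibleᵢ⇒Visible (_ , w , noShorter-pair shG shH , w-avoids))

module _ (G H : Graph) where
  open CartesianProduct (□-isCartesianProduct G H)
  private module H-layers = CartesianProduct (swap (□-isCartesianProduct G H))

  ∣prodSet∣ : ∀ S Y → ∣ prodSet S Y ∣ ≡ ∣ S ∣ * ∣ Y ∣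
  ∣prodSet∣ S Y = trans (∣∣-rows (n G) (prodSet S Y)) (∑F≡∣S∣*c S _ row-full row-empty)
    where
    row-full : ∀ {g} → g ∈ S → ∣ preimage (combine g) (prodSet S Y) ∣ ≡ ∣ Y ∣
    row-full {g} g∈S = cong ∣_∣ (⊆-antisym (proj₂ ∘ ∈prodSet⁻ {S = S} ∘ ∈-preimage⁻ (combine g) (prodSet S Y))
                                           (∈-preimage⁺ (combine g) (prodSet S Y) ∘ ∈prodSet⁺ {Y = Y} g∈S))
    row-empty : ∀ {g} → g ∉ S → ∣ preimage (combine g) (prodSet S Y) ∣ ≡ 0
    row-empty {g} g∉S =
      trans (cong ∣_∣ (Empty-unique λ (_ , m) → g∉S (proj₁ (∈prodSet⁻ {Y = Y} (∈-preimage⁻ (combine g) (prodSet S Y) m)))))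
            (∣⊥∣≡0 (n H))

  ∣tmv∣≤ : ∀ (S : Subset (n G)) {b} → (∀ {X} → IsTotalMutualVisibilitySet G X → X ⊆ S) →
           (∀ Y → IsTotalMutualVisibilitySet H Y → ∣ Y ∣ ≤ b) →
           ∀ {Z} → IsTotalMutualVisibilitySet (G □ H) Z → ∣ Z ∣ ≤ ∣ S ∣ * b
  ∣tmv∣≤ S tmv⊆S maxH {Z} tmvZ =
    ≤-trans (≤-reflexive (∣∣-rows (n G) Z)) (∑F≤∣S∣*c S _ (λ {g} _ → maxH _ (H-layers.layer-tmv g tmvZ)) row-empty)
    where
    -- (g , h) ∈ Z puts g in the G-layer of Z at h, which is a total mutual-visibility set of G.
    row-empty : ∀ {g} → g ∉ S → ∣ preimage (combine g) Z ∣ ≡ 0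
    row-empty {g} g∉S = trans (cong ∣_∣ (Empty-unique λ (h , m) → g∉S (tmv⊆S (layer-tmv h tmvZ)
                                  (∈-preimage⁺ (λ g → combine g h) Z (∈-preimage⁻ (combine g) Z m)))))
                              (∣⊥∣≡0 (n H))

theorem5p6 : (G H : Graph) → Connected G → Connected H
           → (S : Subset (n G)) → (∀ v → (v ∈ S) ⇔ Simplicial G v)
           → Independent G S → IsMuT G ∣ S ∣
           → (b : ℕ) → IsMuT H b
           → IsMuT (G □ H) (∣ S ∣ * b)
theorem5p6 G H _ _ S simplicial⇔ indep ((XG , tmvXG , _) , maxG) b ((Y , tmvY , ∣Y∣≡b) , maxH) =
  (prodSet S Y , tmvX , ∣X∣≡∣S∣*b) , λ Z → ∣tmv∣≤ G H S (tmv⊆simplicial S-simplicial maxG) maxH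
  where
  open CartesianProduct (□-isCartesianProduct G H)

  S-simplicial : ∀ {v} → v ∈ S → Simplicial G v
  S-simplicial = Equivalence.to (simplicial⇔ _)

  -- Adjacency is not decidable, so connectivity does not yield shortest walks constructively.
  geodesic : ∀ g g′ → Geodesic G g g′
  geodesic g g′ = Visible⇒Geodesic (tmvXG g g′)

  tmvX : IsTotalMutualVisibilitySet (G □ H) (prodSet S Y)
  tmvX = prodSet-tmv S-simplicial indep geodesic tmvY

  ∣X∣≡∣S∣*b : ∣ prodSet S Y ∣ ≡ ∣ S ∣ * b
  ∣X∣≡∣S∣*b = trans (∣prodSet∣ G H S Y) (cong (∣ S ∣ *_) ∣Y∣≡b)
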